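{- Let $T$ be an observational commutative monad on a cartesian monoidal category $\mathbb C$ such that for every object $Y$ the pair $\eta_{TY},T\eta_Y:TY\rightrightarrows TTY$ has an equalizer $\theta_Y:DY\to TY$. Then the submonad $D$ of thunkable morphisms characterizes exactly the deterministic morphisms of $\mathsf{Kl}(T)$: a Kleisli morphism $f:X\rightsquigarrow Y$ is deterministic if and only if $f^\sharp$ factors through $\theta_Y$, so that deterministic Kleisli morphisms $X\rightsquigarrow Y$ correspond bijectively to morphisms $X\to DY$ of $\mathbb C$.
   Context: Kleisli morphisms $f:A\rightsquigarrow B$ correspond to $f^\sharp:A\to TB$, composition $(g\circledcirc f)^\sharp=\mu\circ Tg^\sharp\circ f^\sharp$. $\mathsf{Kl}(T)$ is symmetric monoidal with $A\otimes B=A\times B$, $(f\otimes g)^\sharp=\nabla\circ(f^\sharp\times g^\sharp)$ where $\nabla$ is the monoidal structure of the commutative monad; $(\mathsf{copy}_X)^\sharp=\eta\circ\Delta_X$, $(\mathsf{del}_X)^\sharp=\eta_1\circ!_X$. $f$ is deterministic if $\mathsf{copy}_Y\circledcirc f=(f\otimes f)\circledcirc\mathsf{copy}_X$ and $\mathsf{del}_Y\circledcirc f=\mathsf{del}_X$. $(\mathsf{force}_X)^\sharp=1_{TX}$; $\mathsf{copy}_n$ is the iterated copy ($\mathsf{copy}_0=\mathsf{del}$); $\mathsf{samp}_n=\mathsf{force}^{\otimes n}\circledcirc\mathsf{copy}_n:TX\rightsquigarrow X^{\otimes n}$; $T$ is observational if for every $X$ the family $(\mathsf{samp}_n)_{n\in\mathbb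 N}$ is jointly monic in $\mathsf{Kl}(T)$. A Kleisli morphism is thunkable iff $\eta_{TY}\circ f^\sharp=T\eta_Y\circ f^\sharp$; thunkable morphisms $X\rightsquigarrow Y$ correspond to morphisms $X\to DY$ via $u\mapsto\theta_Y\circ u$, and $D$ is the monad on $\mathbb C$ induced by this adjunction (a submonad of $T$ via $\theta$). -}

module Defs where

open import Level using (Level; _⊔_) renaming (suc to lsuc)
open import Data.Nat using (ℕ; zero; suc)
open import Data.Product using (Σ; _,_)
open import Relation.Binary using (Rel; IsEquivalence)

record Category (o ℓ e : Level) : Set (lsuc (o ⊔ ℓ ⊔ e)) where
  infix  4 _≈_
  infixr 9 _∘_
  field
    Obj : Set o
    _⇒_ : Obj → Obj → Set ℓ
    _≈_ : ∀ {A B} → Rel (A ⇒ B) e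
    id  : ∀ {A} → A ⇒ A
    _∘_ : ∀ {A B C} → B ⇒ C → A ⇒ B → A ⇒ C
    equiv     : ∀ {A B} → IsEquivalence (_≈_ {A} {B})
    ∘-resp-≈  : ∀ {A B C} {f h : B ⇒ C} {g i : A ⇒ B} → f ≈ h → g ≈ i → f ∘ g ≈ h ∘ i
    assoc     : ∀ {A B C D} {f : A ⇒ B} {g : B ⇒ C} {h : C ⇒ D} →
                (h ∘ g) ∘ f ≈ h ∘ (g ∘ f)
    identityˡ : ∀ {A B} {f : A ⇒ B} → id ∘ f ≈ f
    identityʳ : ∀ {A B} {f : A ⇒ B} → f ∘ id ≈ f

record Cartesian {o ℓ e} (C : Category o ℓ e) : Set (o ⊔ ℓ ⊔ e) where
  open Category C
  infixr 7 _×_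
  field
    ⊤        : Obj
    !        : ∀ {A} → A ⇒ ⊤
    !-unique : ∀ {A} (f : A ⇒ ⊤) → f ≈ !
    _×_      : Obj → Obj → Obj
    π₁       : ∀ {A B} → (A × B) ⇒ A
    π₂       : ∀ {A B} → (A × B) ⇒ B
    ⟨_,_⟩    : ∀ {A B Z} → Z ⇒ A → Z ⇒ B → Z ⇒ (A × B)
    project₁ : ∀ {A B Z} {f : Z ⇒ A} {g : Z ⇒ B} → π₁ ∘ ⟨ f , g ⟩ ≈ f
    project₂ : ∀ {A B Z} {f : Z ⇒ A} {g : Z ⇒ B} → π₂ ∘ ⟨ f , g ⟩ ≈ g
    unique   : ∀ {A B Z} {f : Z ⇒ A} {g : Z ⇒ B} {h : Z ⇒ (A × B)} →
               π₁ ∘ h ≈ f → π₂ ∘ h ≈ g → ⟨ f , g ⟩ ≈ h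

  infixr 8 _⁂_
  _⁂_ : ∀ {A B A' B'} → A ⇒ A' → B ⇒ B' → (A × B) ⇒ (A' × B')
  f ⁂ g = ⟨ f ∘ π₁ , g ∘ π₂ ⟩

  Δ : ∀ {A} → A ⇒ (A × A)
  Δ = ⟨ id , id ⟩

  swap : ∀ {A B} → (A × B) ⇒ (B × A)
  swap = ⟨ π₂ , π₁ ⟩

  assocʳ : ∀ {A B C} → ((A × B) × C) ⇒ (A × (B × C))
  assocʳ = ⟨ π₁ ∘ π₁ , ⟨ π₂ ∘ π₁ , π₂ ⟩ ⟩

record Monad {o ℓ e} (C : Category o ℓ e) : Set (o ⊔ ℓ ⊔ e) where
  open Category C
  field
    T₀       : Obj → Obj
    T₁       : ∀ {A B} → A ⇒ B → T₀ A ⇒ T₀ B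
    T-resp-≈ : ∀ {A B} {f g : A ⇒ B} → f ≈ g → T₁ f ≈ T₁ g
    T-id     : ∀ {A} → T₁ (id {A}) ≈ id
    T-∘      : ∀ {A B C} {f : A ⇒ B} {g : B ⇒ C} → T₁ (g ∘ f) ≈ T₁ g ∘ T₁ f
    η        : ∀ A → A ⇒ T₀ A
    μ        : ∀ A → T₀ (T₀ A) ⇒ T₀ A
    η-natural : ∀ {A B} {f : A ⇒ B} → η B ∘ f ≈ T₁ f ∘ η A
    μ-natural : ∀ {A B} {f : A ⇒ B} → μ B ∘ T₁ (T₁ f) ≈ T₁ f ∘ μ A
    μ-assoc   : ∀ {A} → μ A ∘ T₁ (μ A) ≈ μ A ∘ μ (T₀ A)
    μ-unitˡ   : ∀ {A} → μ A ∘ T₁ (η A) ≈ id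
    μ-unitʳ   : ∀ {A} → μ A ∘ η (T₀ A) ≈ id

-- A commutative monad on a cartesian category, presented (equivalently, by
-- Kock) as a symmetric monoidal monad: a monad with a lax symmetric monoidal
-- structure ∇ : TA × TB → T(A × B) (unit map η ⊤ : ⊤ → T⊤) such that η and μ
-- are monoidal natural transformations.
record CommutativeMonad {o ℓ e} (C : Category o ℓ e) (Cart : Cartesian C)
       : Set (o ⊔ ℓ ⊔ e) where
  open Category C
  open Cartesian Cart
  field
    monad : Monad C
  open Monad monad
  field
    ∇ : ∀ A B → (T₀ A × T₀ B) ⇒ T₀ (A × B)
    ∇-natural : ∀ {A B A' B'} {f : A ⇒ A'} {g : B ⇒ B'} →
                ∇ A' B' ∘ (T₁ f ⁂ T₁ g) ≈ T₁ (f ⁂ g) ∘ ∇ A B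
    ∇-assoc   : ∀ {A B C'} →
                T₁ (assocʳ {A} {B} {C'}) ∘ ∇ (A × B) C' ∘ (∇ A B ⁂ id)
                  ≈ ∇ A (B × C') ∘ (id ⁂ ∇ B C') ∘ assocʳ
    ∇-unitˡ   : ∀ {A} → T₁ π₂ ∘ ∇ ⊤ A ∘ (η ⊤ ⁂ id) ≈ π₂
    ∇-unitʳ   : ∀ {A} → T₁ π₁ ∘ ∇ A ⊤ ∘ (id ⁂ η ⊤) ≈ π₁
    ∇-symm    : ∀ {A B} → T₁ swap ∘ ∇ A B ≈ ∇ B A ∘ swap
    ∇-η       : ∀ {A B} → ∇ A B ∘ (η A ⁂ η B) ≈ η (A × B)
    ∇-μ       : ∀ {A B} → ∇ A B ∘ (μ A ⁂ μ B)
                  ≈ μ (A × B) ∘ T₁ (∇ A B) ∘ ∇ (T₀ A) (T₀ B)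

module Kleisli {o ℓ e} {C : Category o ℓ e} {Cart : Cartesian C}
               (CM : CommutativeMonad C Cart) where
  open Category C
  open Cartesian Cart
  open CommutativeMonad CM
  open Monad monad

  -- Kleisli morphisms A ⇝ B are represented by their f♯ : A ⇒ T B.
  _⇝_ : Obj → Obj → Set ℓ
  A ⇝ B = A ⇒ T₀ B

  infixr 9 _⊚_
  _⊚_ : ∀ {A B C'} → B ⇝ C' → A ⇝ B → A ⇝ C'
  g ⊚ f = μ _ ∘ T₁ g ∘ f

  kid : ∀ {A} → A ⇝ A
  kid = η _

  infixr 8 _⊗_
  _⊗_ : ∀ {A B A' B'} → A ⇝ A' → B ⇝ B' → (A × B) ⇝ (A' × B')
  f ⊗ g = ∇ _ _ ∘ (f ⁂ g)

  copy : ∀ X → X ⇝ (X × X)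
  copy X = η (X × X) ∘ Δ

  del : ∀ X → X ⇝ ⊤
  del X = η ⊤ ∘ !

  Deterministic : ∀ {X Y} → X ⇝ Y → Set e
  Deterministic {X} {Y} f =
    Σ (copy Y ⊚ f ≈ (f ⊗ f) ⊚ copy X) (λ _ → del Y ⊚ f ≈ del X)

  force : ∀ X → T₀ X ⇝ X
  force X = id

  pow : Obj → ℕ → Obj
  pow X zero          = ⊤
  pow X (suc zero)    = X
  pow X (suc (suc n)) = X × pow X (suc n)

  copyN : ∀ X n → X ⇝ pow X n
  copyN X zero          = del X
  copyN X (suc zero)    = kid
  copyN X (suc (suc n)) = (kid ⊗ copyN X (suc n)) ⊚ copy X

  forceN : ∀ X n → pow (T₀ X) n ⇝ pow X n
  forceN X zero          = kid
  forceN X (suc zero)    = force X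
  forceN X (suc (suc n)) = force X ⊗ forceN X (suc n)

  samp : ∀ X n → T₀ X ⇝ pow X n
  samp X n = forceN X n ⊚ copyN (T₀ X) n

  JointlyMonicSamp : Obj → Set (o ⊔ ℓ ⊔ e)
  JointlyMonicSamp X = ∀ {Z} (f g : Z ⇝ T₀ X) →
    (∀ n → samp X n ⊚ f ≈ samp X n ⊚ g) → f ≈ g

  Observational : Set (o ⊔ ℓ ⊔ e)
  Observational = ∀ X → JointlyMonicSamp X

  record ThunkEqualizer (Y : Obj) : Set (o ⊔ ℓ ⊔ e) where
    field
      D   : Obj
      θ   : D ⇒ T₀ Y
      equalizes : η (T₀ Y) ∘ θ ≈ T₁ (η Y) ∘ θ
      factor    : ∀ {Z} (h : Z ⇒ T₀ Y) → η (T₀ Y) ∘ h ≈ T₁ (η Y) ∘ h → Z ⇒ D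
      factor-eq : ∀ {Z} (h : Z ⇒ T₀ Y) (p : η (T₀ Y) ∘ h ≈ T₁ (η Y) ∘ h) →
                  θ ∘ factor h p ≈ h
      factor-unique : ∀ {Z} (h : Z ⇒ T₀ Y) (p : η (T₀ Y) ∘ h ≈ T₁ (η Y) ∘ h)
                      (u : Z ⇒ D) → θ ∘ u ≈ h → u ≈ factor h p

{-# OPTIONS --safe #-}
-- Call f : X ⇝ Y thunkable when η ∘ f♯ ≈ Tη ∘ f♯. Post-composing the n-th sampling
-- map turns η ∘ f♯ into f^{⊗n} ∘ Δₙ and Tη ∘ f♯ into copyₙ ⊚ f, so by observationality f is
-- thunkable exactly when it commutes with every iterated copy. Commuting with copy₀ and
-- copy₂ is determinism, and determinism yields commutation with all copyₙ by induction
-- on n. Thunkable morphisms are exactly those factoring through the equalizer θ, and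
-- the factorization is unique because equalizers are monic.
module Submission where

open import Defs
open import Level using (Level)
open import Data.Product using (Σ; _×_; _,_)
open import Data.Nat using (zero; suc)
open import Relation.Binary using (Setoid; IsEquivalence)
import Relation.Binary.Reasoning.Setoid as SetoidReasoning

module HomReasoning {o ℓ e} (C : Category o ℓ e) where
  open Category C

  hom-setoid : Obj → Obj → Setoid ℓ e
  hom-setoid A B = record { Carrier = A ⇒ B ; _≈_ = _≈_ ; isEquivalence = equiv }

  module _ {A B : Obj} where
    open SetoidReasoning (hom-setoid A B) public
    open IsEquivalence (equiv {A} {B}) public
      renaming (refl to ≈-refl; sym to ≈-sym; trans to ≈-trans)

  ∘-resp-≈ˡ : ∀ {A B D} {f h : B ⇒ D} {g : A ⇒ B} → f ≈ h → f ∘ g ≈ h ∘ g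
  ∘-resp-≈ˡ p = ∘-resp-≈ p ≈-refl

  ∘-resp-≈ʳ : ∀ {A B D} {f : B ⇒ D} {g i : A ⇒ B} → g ≈ i → f ∘ g ≈ f ∘ i
  ∘-resp-≈ʳ p = ∘-resp-≈ ≈-refl p

  sym-assoc : ∀ {A B D E} {f : A ⇒ B} {g : B ⇒ D} {h : D ⇒ E} →
              h ∘ (g ∘ f) ≈ (h ∘ g) ∘ f
  sym-assoc = ≈-sym assoc

module CartesianProperties {o ℓ e} {C : Category o ℓ e} (Cart : Cartesian C) where
  open Category C
  open Cartesian Cart
  open HomReasoning C

  ⟨⟩-cong : ∀ {A B Z} {f f' : Z ⇒ A} {g g' : Z ⇒ B} →
            f ≈ f' → g ≈ g' → ⟨ f , g ⟩ ≈ ⟨ f' , g' ⟩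
  ⟨⟩-cong p q = unique (≈-trans project₁ (≈-sym p)) (≈-trans project₂ (≈-sym q))

  ⟨⟩∘ : ∀ {A B Z W} {f : Z ⇒ A} {g : Z ⇒ B} {h : W ⇒ Z} →
        ⟨ f , g ⟩ ∘ h ≈ ⟨ f ∘ h , g ∘ h ⟩
  ⟨⟩∘ = ≈-sym (unique (≈-trans sym-assoc (∘-resp-≈ˡ project₁))
                      (≈-trans sym-assoc (∘-resp-≈ˡ project₂)))

  ⁂∘⟨⟩ : ∀ {A B A' B' Z} {a : A ⇒ A'} {b : B ⇒ B'} {c : Z ⇒ A} {d : Z ⇒ B} →
         (a ⁂ b) ∘ ⟨ c , d ⟩ ≈ ⟨ a ∘ c , b ∘ d ⟩
  ⁂∘⟨⟩ = ≈-trans ⟨⟩∘ (⟨⟩-cong (≈-trans assoc (∘-resp-≈ʳ project₁))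
                             (≈-trans assoc (∘-resp-≈ʳ project₂)))

  ⁂∘⁂ : ∀ {A B A' B' A'' B''} {a : A' ⇒ A''} {b : B' ⇒ B''} {c : A ⇒ A'} {d : B ⇒ B'} →
        (a ⁂ b) ∘ (c ⁂ d) ≈ (a ∘ c) ⁂ (b ∘ d)
  ⁂∘⁂ = ≈-trans ⁂∘⟨⟩ (⟨⟩-cong sym-assoc sym-assoc)

  ⁂-cong : ∀ {A B A' B'} {a a' : A ⇒ A'} {b b' : B ⇒ B'} →
           a ≈ a' → b ≈ b' → (a ⁂ b) ≈ (a' ⁂ b')
  ⁂-cong p q = ⟨⟩-cong (∘-resp-≈ˡ p) (∘-resp-≈ˡ q)

module KleisliProperties {o ℓ e} {C : Category o ℓ e} {Cart : Cartesian C}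
                         (CM : CommutativeMonad C Cart) where
  open Category C
  open Cartesian Cart
  open CommutativeMonad CM
  open Monad monad
  open Kleisli CM
  open HomReasoning C
  open CartesianProperties Cart

  ⊚-resp-≈ : ∀ {A B D} {g g' : B ⇝ D} {f f' : A ⇝ B} → g ≈ g' → f ≈ f' → g ⊚ f ≈ g' ⊚ f'
  ⊚-resp-≈ p q = ∘-resp-≈ʳ (∘-resp-≈ (T-resp-≈ p) q)

  ⊗-resp-≈ : ∀ {A B A' B'} {f f' : A ⇝ A'} {g g' : B ⇝ B'} → f ≈ f' → g ≈ g' → f ⊗ g ≈ f' ⊗ g'
  ⊗-resp-≈ p q = ∘-resp-≈ʳ (⁂-cong p q)

  ⊚-pure : ∀ {A B D} (g : B ⇝ D) (k : A ⇒ B) → g ⊚ (η B ∘ k) ≈ g ∘ k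
  ⊚-pure g k = begin
    μ _ ∘ T₁ g ∘ η _ ∘ k      ≈⟨ ∘-resp-≈ʳ sym-assoc ⟩
    μ _ ∘ (T₁ g ∘ η _) ∘ k    ≈⟨ ∘-resp-≈ʳ (∘-resp-≈ˡ η-natural) ⟨
    μ _ ∘ (η _ ∘ g) ∘ k       ≈⟨ ≈-trans (∘-resp-≈ʳ assoc) sym-assoc ⟩
    (μ _ ∘ η _) ∘ g ∘ k       ≈⟨ ∘-resp-≈ˡ μ-unitʳ ⟩
    id ∘ g ∘ k                ≈⟨ identityˡ ⟩
    g ∘ k                     ∎

  ⊚-identityˡ : ∀ {A B} (f : A ⇝ B) → kid ⊚ f ≈ f
  ⊚-identityˡ f = ≈-trans sym-assoc (≈-trans (∘-resp-≈ˡ μ-unitˡ) identityˡ)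

  ⊚-assoc : ∀ {A B D E} {h : D ⇝ E} {g : B ⇝ D} {f : A ⇝ B} →
            (h ⊚ g) ⊚ f ≈ h ⊚ (g ⊚ f)
  ⊚-assoc {h = h} {g} {f} = begin
    μ _ ∘ T₁ (μ _ ∘ T₁ h ∘ g) ∘ f             ≈⟨ ∘-resp-≈ʳ (∘-resp-≈ˡ (≈-trans T-∘ (∘-resp-≈ʳ T-∘))) ⟩
    μ _ ∘ (T₁ (μ _) ∘ T₁ (T₁ h) ∘ T₁ g) ∘ f   ≈⟨ ≈-trans (∘-resp-≈ʳ (≈-trans assoc (∘-resp-≈ʳ assoc))) sym-assoc ⟩
    (μ _ ∘ T₁ (μ _)) ∘ T₁ (T₁ h) ∘ T₁ g ∘ f   ≈⟨ ∘-resp-≈ˡ μ-assoc ⟩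
    (μ _ ∘ μ _) ∘ T₁ (T₁ h) ∘ T₁ g ∘ f        ≈⟨ ≈-trans assoc (∘-resp-≈ʳ sym-assoc) ⟩
    μ _ ∘ (μ _ ∘ T₁ (T₁ h)) ∘ T₁ g ∘ f        ≈⟨ ∘-resp-≈ʳ (∘-resp-≈ˡ μ-natural) ⟩
    μ _ ∘ (T₁ h ∘ μ _) ∘ T₁ g ∘ f             ≈⟨ ∘-resp-≈ʳ assoc ⟩
    μ _ ∘ T₁ h ∘ μ _ ∘ T₁ g ∘ f               ∎

  ⊗-⊚-interchange : ∀ {A B A' B' A'' B''} {g : A' ⇝ A''} {g' : B' ⇝ B''} {f : A ⇝ A'} {f' : B ⇝ B'} →
                    (g ⊗ g') ⊚ (f ⊗ f') ≈ (g ⊚ f) ⊗ (g' ⊚ f')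
  ⊗-⊚-interchange {g = g} {g'} {f} {f'} = begin
    μ _ ∘ T₁ (∇ _ _ ∘ (g ⁂ g')) ∘ ∇ _ _ ∘ (f ⁂ f')            ≈⟨ ∘-resp-≈ʳ (≈-trans (∘-resp-≈ˡ T-∘) (≈-trans assoc (∘-resp-≈ʳ sym-assoc))) ⟩
    μ _ ∘ T₁ (∇ _ _) ∘ (T₁ (g ⁂ g') ∘ ∇ _ _) ∘ (f ⁂ f')       ≈⟨ ∘-resp-≈ʳ (∘-resp-≈ʳ (∘-resp-≈ˡ ∇-natural)) ⟨
    μ _ ∘ T₁ (∇ _ _) ∘ (∇ _ _ ∘ (T₁ g ⁂ T₁ g')) ∘ (f ⁂ f')    ≈⟨ ≈-trans (∘-resp-≈ʳ (∘-resp-≈ʳ assoc)) (≈-trans sym-assoc (≈-trans sym-assoc (∘-resp-≈ˡ assoc))) ⟩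
    (μ _ ∘ T₁ (∇ _ _) ∘ ∇ _ _) ∘ (T₁ g ⁂ T₁ g') ∘ (f ⁂ f')    ≈⟨ ∘-resp-≈ˡ ∇-μ ⟨
    (∇ _ _ ∘ (μ _ ⁂ μ _)) ∘ (T₁ g ⁂ T₁ g') ∘ (f ⁂ f')         ≈⟨ ≈-trans assoc (∘-resp-≈ʳ (≈-trans (∘-resp-≈ʳ ⁂∘⁂) ⁂∘⁂)) ⟩
    ∇ _ _ ∘ ((g ⊚ f) ⁂ (g' ⊚ f'))                             ∎

  diag : ∀ {X} n → X ⇒ pow X n
  diag zero          = !
  diag (suc zero)    = id
  diag (suc (suc n)) = ⟨ id , diag (suc n) ⟩

  powmap : ∀ {A B} n → A ⇒ B → pow A n ⇒ pow B n
  powmap zero          g = id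
  powmap (suc zero)    g = g
  powmap (suc (suc n)) g = g ⁂ powmap (suc n) g

  infixl 10 _^⊗_
  _^⊗_ : ∀ {A B} → A ⇝ B → ∀ n → pow A n ⇝ pow B n
  f ^⊗ zero          = kid
  f ^⊗ suc zero      = f
  f ^⊗ suc (suc n)   = f ⊗ f ^⊗ suc n

  diag-natural : ∀ {A B} n (g : A ⇒ B) → diag n ∘ g ≈ powmap n g ∘ diag n
  diag-natural zero          g = ≈-trans (!-unique _) (≈-sym (!-unique _))
  diag-natural (suc zero)    g = ≈-trans identityˡ (≈-sym identityʳ)
  diag-natural (suc (suc n)) g = begin
    ⟨ id , diag (suc n) ⟩ ∘ g                             ≈⟨ ⟨⟩∘ ⟩
    ⟨ id ∘ g , diag (suc n) ∘ g ⟩                         ≈⟨ ⟨⟩-cong (≈-trans identityˡ (≈-sym identityʳ)) (diag-natural (suc n) g) ⟩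
    ⟨ g ∘ id , powmap (suc n) g ∘ diag (suc n) ⟩          ≈⟨ ⁂∘⟨⟩ ⟨
    (g ⁂ powmap (suc n) g) ∘ ⟨ id , diag (suc n) ⟩        ∎

  copyN≈η∘diag : ∀ X n → copyN X n ≈ η (pow X n) ∘ diag n
  copyN≈η∘diag X zero          = ≈-refl
  copyN≈η∘diag X (suc zero)    = ≈-sym identityʳ
  copyN≈η∘diag X (suc (suc n)) = begin
    (kid ⊗ copyN X (suc n)) ⊚ (η _ ∘ Δ)                      ≈⟨ ⊚-pure _ _ ⟩
    (∇ _ _ ∘ (η _ ⁂ copyN X (suc n))) ∘ Δ                    ≈⟨ ∘-resp-≈ˡ (∘-resp-≈ʳ (⁂-cong (≈-sym identityʳ) (copyN≈η∘diag X (suc n)))) ⟩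
    (∇ _ _ ∘ ((η _ ∘ id) ⁂ (η _ ∘ diag (suc n)))) ∘ Δ        ≈⟨ ∘-resp-≈ˡ (≈-trans (∘-resp-≈ʳ (≈-sym ⁂∘⁂)) sym-assoc) ⟩
    ((∇ _ _ ∘ (η _ ⁂ η _)) ∘ (id ⁂ diag (suc n))) ∘ Δ        ≈⟨ ≈-trans (∘-resp-≈ˡ (∘-resp-≈ˡ ∇-η)) assoc ⟩
    η _ ∘ (id ⁂ diag (suc n)) ∘ Δ                            ≈⟨ ∘-resp-≈ʳ (≈-trans ⁂∘⟨⟩ (⟨⟩-cong identityʳ identityʳ)) ⟩
    η _ ∘ diag (suc (suc n))                                 ∎

  forceN∘powmap : ∀ {X Y} n (h : X ⇒ T₀ Y) → forceN Y n ∘ powmap n h ≈ h ^⊗ n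
  forceN∘powmap zero          h = identityʳ
  forceN∘powmap (suc zero)    h = identityˡ
  forceN∘powmap (suc (suc n)) h = begin
    (∇ _ _ ∘ (id ⁂ forceN _ (suc n))) ∘ (h ⁂ powmap (suc n) h)    ≈⟨ ≈-trans assoc (∘-resp-≈ʳ ⁂∘⁂) ⟩
    ∇ _ _ ∘ ((id ∘ h) ⁂ (forceN _ (suc n) ∘ powmap (suc n) h))    ≈⟨ ∘-resp-≈ʳ (⁂-cong identityˡ (forceN∘powmap (suc n) h)) ⟩
    ∇ _ _ ∘ (h ⁂ h ^⊗ suc n)                                       ∎

  η-^⊗ : ∀ {Y} n → η Y ^⊗ n ≈ η (pow Y n)
  η-^⊗ zero          = ≈-refl
  η-^⊗ (suc zero)    = ≈-refl
  η-^⊗ (suc (suc n)) = ≈-trans (∘-resp-≈ʳ (⁂-cong ≈-refl (η-^⊗ (suc n)))) ∇-η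

  samp∘ : ∀ {X Y} n (h : X ⇒ T₀ Y) → samp Y n ∘ h ≈ h ^⊗ n ∘ diag n
  samp∘ {Y = Y} n h = begin
    (μ _ ∘ T₁ (forceN Y n) ∘ copyN (T₀ Y) n) ∘ h     ≈⟨ ≈-trans assoc (∘-resp-≈ʳ assoc) ⟩
    forceN Y n ⊚ (copyN (T₀ Y) n ∘ h)                 ≈⟨ ⊚-resp-≈ ≈-refl (≈-trans (∘-resp-≈ˡ (copyN≈η∘diag _ n)) assoc) ⟩
    forceN Y n ⊚ (η _ ∘ diag n ∘ h)                   ≈⟨ ⊚-pure _ _ ⟩
    forceN Y n ∘ diag n ∘ h                           ≈⟨ ∘-resp-≈ʳ (diag-natural n h) ⟩
    forceN Y n ∘ powmap n h ∘ diag n                  ≈⟨ ≈-trans sym-assoc (∘-resp-≈ˡ (forceN∘powmap n h)) ⟩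
    h ^⊗ n ∘ diag n                                   ∎

  samp∘η : ∀ {Y} n → samp Y n ∘ η Y ≈ copyN Y n
  samp∘η n = ≈-trans (samp∘ n _) (≈-trans (∘-resp-≈ˡ (η-^⊗ n)) (≈-sym (copyN≈η∘diag _ n)))

  samp-⊚-η∘ : ∀ {X Y} n (f : X ⇝ Y) → samp Y n ⊚ (η (T₀ Y) ∘ f) ≈ f ^⊗ n ∘ diag n
  samp-⊚-η∘ n f = ≈-trans (⊚-pure _ f) (samp∘ n f)

  samp-⊚-Tη∘ : ∀ {X Y} n (f : X ⇝ Y) → samp Y n ⊚ (T₁ (η Y) ∘ f) ≈ copyN Y n ⊚ f
  samp-⊚-Tη∘ n f = begin
    μ _ ∘ T₁ (samp _ n) ∘ T₁ (η _) ∘ f     ≈⟨ ∘-resp-≈ʳ (≈-trans (∘-resp-≈ˡ T-∘) assoc) ⟨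
    μ _ ∘ T₁ (samp _ n ∘ η _) ∘ f          ≈⟨ ∘-resp-≈ʳ (∘-resp-≈ˡ (T-resp-≈ (samp∘η n))) ⟩
    μ _ ∘ T₁ (copyN _ n) ∘ f               ∎

  Thunkable : ∀ {X Y} → X ⇝ Y → Set e
  Thunkable {Y = Y} f = η (T₀ Y) ∘ f ≈ T₁ (η Y) ∘ f

  CommutesWithCopies : ∀ {X Y} → X ⇝ Y → Set e
  CommutesWithCopies {Y = Y} f = ∀ n → copyN Y n ⊚ f ≈ f ^⊗ n ∘ diag n

  thunkable⇒commutesWithCopies : ∀ {X Y} (f : X ⇝ Y) → Thunkable f → CommutesWithCopies f
  thunkable⇒commutesWithCopies f thunk n = begin
    copyN _ n ⊚ f                  ≈⟨ samp-⊚-Tη∘ n f ⟨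
    samp _ n ⊚ (T₁ (η _) ∘ f)      ≈⟨ ⊚-resp-≈ ≈-refl thunk ⟨
    samp _ n ⊚ (η _ ∘ f)           ≈⟨ samp-⊚-η∘ n f ⟩
    f ^⊗ n ∘ diag n                ∎

  commutesWithCopies⇒thunkable : ∀ {X Y} → JointlyMonicSamp Y →
                                 (f : X ⇝ Y) → CommutesWithCopies f → Thunkable f
  commutesWithCopies⇒thunkable monic f commutes = monic _ _ λ n → begin
    samp _ n ⊚ (η _ ∘ f)           ≈⟨ samp-⊚-η∘ n f ⟩
    f ^⊗ n ∘ diag n                ≈⟨ commutes n ⟨
    copyN _ n ⊚ f                  ≈⟨ samp-⊚-Tη∘ n f ⟨
    samp _ n ⊚ (T₁ (η _) ∘ f)      ∎

  deterministic⇒commutesWithCopies : ∀ {X Y} (f : X ⇝ Y) → Deterministic f → CommutesWithCopies f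
  deterministic⇒commutesWithCopies f (_ , discardable) zero = discardable
  deterministic⇒commutesWithCopies f _ (suc zero) = ≈-trans (⊚-identityˡ f) (≈-sym identityʳ)
  deterministic⇒commutesWithCopies {X} {Y} f det@(copyable , _) (suc (suc n)) = begin
    ((kid ⊗ c) ⊚ copy Y) ⊚ f                        ≈⟨ ≈-trans ⊚-assoc (⊚-resp-≈ ≈-refl copyable) ⟩
    (kid ⊗ c) ⊚ ((f ⊗ f) ⊚ copy X)                  ≈⟨ ≈-trans (≈-sym ⊚-assoc) (⊚-resp-≈ ⊗-⊚-interchange ≈-refl) ⟩
    ((kid ⊚ f) ⊗ (c ⊚ f)) ⊚ copy X                  ≈⟨ ⊚-resp-≈ (⊗-resp-≈ (⊚-identityˡ f) (deterministic⇒commutesWithCopies f det (suc n))) ≈-refl ⟩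
    (f ⊗ (f ^⊗ suc n ∘ diag (suc n))) ⊚ copy X      ≈⟨ ≈-trans (⊚-pure _ _) assoc ⟩
    ∇ _ _ ∘ (f ⁂ (f ^⊗ suc n ∘ diag (suc n))) ∘ Δ   ≈⟨ ∘-resp-≈ʳ (≈-trans ⁂∘⟨⟩ (⟨⟩-cong ≈-refl identityʳ)) ⟩
    ∇ _ _ ∘ ⟨ f ∘ id , f ^⊗ suc n ∘ diag (suc n) ⟩  ≈⟨ ≈-trans (∘-resp-≈ʳ (≈-sym ⁂∘⟨⟩)) sym-assoc ⟩
    f ^⊗ suc (suc n) ∘ diag (suc (suc n))           ∎
    where c = copyN Y (suc n)

  commutesWithCopies⇒deterministic : ∀ {X Y} (f : X ⇝ Y) → CommutesWithCopies f → Deterministic f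
  commutesWithCopies⇒deterministic {X} {Y} f commutes = copyable , commutes 0
    where
    copyable : copy Y ⊚ f ≈ (f ⊗ f) ⊚ copy X
    copyable = begin
      copy Y ⊚ f           ≈⟨ ⊚-resp-≈ (copyN≈η∘diag Y 2) ≈-refl ⟨
      copyN Y 2 ⊚ f        ≈⟨ commutes 2 ⟩
      (f ⊗ f) ∘ Δ          ≈⟨ ⊚-pure _ _ ⟨
      (f ⊗ f) ⊚ copy X     ∎

  module _ {Y} (E : ThunkEqualizer Y) where
    open ThunkEqualizer E

    factors⇒thunkable : ∀ {X} {f : X ⇝ Y} (u : X ⇒ D) → θ ∘ u ≈ f → Thunkable f
    factors⇒thunkable {f = f} u θu≈f = begin
      η _ ∘ f              ≈⟨ ∘-resp-≈ʳ θu≈f ⟨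
      η _ ∘ θ ∘ u          ≈⟨ ≈-trans sym-assoc (≈-trans (∘-resp-≈ˡ equalizes) assoc) ⟩
      T₁ (η Y) ∘ θ ∘ u     ≈⟨ ∘-resp-≈ʳ θu≈f ⟩
      T₁ (η Y) ∘ f         ∎

    θ-monic : ∀ {X} (u v : X ⇒ D) → θ ∘ u ≈ θ ∘ v → u ≈ v
    θ-monic u v θu≈θv = ≈-trans (factor-unique (θ ∘ v) thunk u θu≈θv)
                               (≈-sym (factor-unique (θ ∘ v) thunk v ≈-refl))
      where thunk = factors⇒thunkable v ≈-refl

corollary7p2 : ∀ {o ℓ e : Level} (C : Category o ℓ e) (Cart : Cartesian C)
    (T : CommutativeMonad C Cart) →
    let open Category C in
    let open Kleisli T in
    Observational →
    (E : ∀ Y → ThunkEqualizer Y) →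
    ∀ {X Y} →
    -- f is deterministic iff f♯ factors through θ_Y
    ((f : X ⇝ Y) →
      (Deterministic f → Σ (X ⇒ ThunkEqualizer.D (E Y))
                            (λ u → ThunkEqualizer.θ (E Y) ∘ u ≈ f))
      × (Σ (X ⇒ ThunkEqualizer.D (E Y)) (λ u → ThunkEqualizer.θ (E Y) ∘ u ≈ f)
           → Deterministic f))
    -- and u ↦ θ_Y ∘ u is injective, so deterministic X ⇝ Y ≅ (X ⇒ D Y)
    × ((u v : X ⇒ ThunkEqualizer.D (E Y)) →
        ThunkEqualizer.θ (E Y) ∘ u ≈ ThunkEqualizer.θ (E Y) ∘ v → u ≈ v)
corollary7p2 C Cart T observational E {X} {Y} =
  (λ f → deterministic⇒factors f , factors⇒deterministic f) , θ-monic (E Y)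
  where
  open Category C
  open Kleisli T
  open KleisliProperties T
  open ThunkEqualizer (E Y)

  deterministic⇒factors : (f : X ⇝ Y) → Deterministic f → Σ (X ⇒ D) (λ u → θ ∘ u ≈ f)
  deterministic⇒factors f det = factor f thunk , factor-eq f thunk
    where
    thunk : Thunkable f
    thunk = commutesWithCopies⇒thunkable (observational Y) f
              (deterministic⇒commutesWithCopies f det)

  factors⇒deterministic : (f : X ⇝ Y) → Σ (X ⇒ D) (λ u → θ ∘ u ≈ f) → Deterministic f
  factors⇒deterministic f (u , θu≈f) =
    commutesWithCopies⇒deterministic f
      (thunkable⇒commutesWithCopies f (factors⇒thunkable (E Y) u θu≈f))
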